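{- Let $n=\prod_{i=1}^m p_i^{r_i}$ be the factorization of a positive integer $n$ into powers of distinct primes, and write the cyclic group $C_n$ as the internal direct product $C_n=C_{p_1^{r_1}}\times C_{p_2^{r_2}}\times\cdots\times C_{p_m^{r_m}}$ of its Sylow subgroups. Let $\mathrm{Cay}(C_n,S)$ be a Cayley digraph of $C_n$. Assume that for some $1\leq t\leq m$ the prime $p_t$ is odd and that $\mathrm{Aut}(C_n,S)$ contains an element of order $p_t$ that lies in $\mathrm{Aut}(C_{p_t^{r_t}})$ (regarded as a subgroup of $\mathrm{Aut}(C_n)$ as described in the context). Then $\mathrm{Cay}(C_n,S)$ is not normal.
   Context: For a group $G$ and a subset $S\subseteq G$ with $1\notin S$, the Cayley digraph $\mathrm{Cay}(G,S)$ has vertex set $G$ and arc set $\{(g,sg)\mid g\in G, s\in S\}$. The right regular representation is $R(G)=\{R(g)\mid g\in G\}$, where $x^{R(g)}=xg$; $\mathrm{Cay}(G,S)$ is called normal if $R(G)$ is a normal subgroup of $\mathrm{Aut}(\mathrm{Cay}(G,S))$. $\mathrm{Aut}(G,S)=\{\alpha\in\mathrm{Aut}(G)\mid S^\alpha=S\}$. If $G=G_1\times\cdots\times G_m$ is a direct product, each $\alpha_i\in\mathrm{Aut}(G_i)$ is extended to an automorphism of $G$ by $(g_1\cdots g_{i-1}g_ig_{i+1}\cdots g_m)^{\alpha_i}=g_1\cdots g_{i-1}g_i^{\alpha_i}g_{i+1}\cdots g_m$ for $g_j\in G_j$; via this extension $\mathrm{Aut}(G_i)$ is regarded as a subgroup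 of $\mathrm{Aut}(G)$. -}

module Defs where

open import Level using (0ℓ)
open import Data.Nat using (ℕ; zero; suc; _+_; _*_; NonZero)
open import Data.Nat.DivMod using (_mod_)
open import Data.Fin using (Fin; toℕ)
open import Data.Fin.Subset using (Subset; _∈_; _∉_)
open import Data.Product using (Σ; ∃; ∃-syntax; _×_)
open import Function.Bundles using (_↔_; _⇔_; Inverse)
open import Relation.Binary.PropositionalEquality using (_≡_; _≢_)

-- The cyclic group C_n, modelled additively as ℤ/nℤ on Fin n.
module _ {n : ℕ} .{{_ : NonZero n}} where

  𝟘 : Fin n
  𝟘 = 0 mod n

  _⊕_ : Fin n → Fin n → Fin n
  x ⊕ y = (toℕ x + toℕ y) mod n

  _·_ : ℕ → Fin n → Fin n
  k · x = (k * toℕ x) mod n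

  Arc : Subset n → Fin n → Fin n → Set
  Arc S x y = ∃[ s ] (s ∈ S × y ≡ s ⊕ x)

  IsDigraphAut : Subset n → (Fin n ↔ Fin n) → Set
  IsDigraphAut S σ = ∀ x y → Arc S x y ⇔ Arc S (Inverse.to σ x) (Inverse.to σ y)

  R : Fin n → Fin n → Fin n
  R g x = x ⊕ g

  -- Cay(C_n,S) is normal: R(C_n) is normal in Aut(Cay(C_n,S)), i.e.
  -- σ⁻¹ R(g) σ ∈ R(C_n) for every σ ∈ Aut(Cay(C_n,S)) and g ∈ C_n.
  -- (maps act on the right: x^{σ⁻¹ R(g) σ} = σ(R g (σ⁻¹ x)))
  IsNormalCayley : Subset n → Set
  IsNormalCayley S =
    ∀ (σ : Fin n ↔ Fin n) → IsDigraphAut S σ →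
    ∀ g → ∃[ h ] (∀ x → Inverse.to σ (R g (Inverse.from σ x)) ≡ R h x)

  IsGroupAut : (Fin n ↔ Fin n) → Set
  IsGroupAut α = ∀ x y → Inverse.to α (x ⊕ y) ≡ Inverse.to α x ⊕ Inverse.to α y

  FixesSet : (Fin n ↔ Fin n) → Subset n → Set
  FixesSet α S = ∀ x → (x ∈ S → Inverse.to α x ∈ S) × (Inverse.to α x ∈ S → x ∈ S)

iter : {A : Set} → ℕ → (A → A) → A → A
iter zero    f x = x
iter (suc k) f x = f (iter k f x)

module _ {n : ℕ} .{{_ : NonZero n}} where
  -- α has order exactly the prime p (p prime: α^p = 1 and α ≠ 1)
  HasPrimeOrder : ℕ → (Fin n ↔ Fin n) → Set
  HasPrimeOrder p α =
    (∀ x → iter p (Inverse.to α) x ≡ x) × (∃[ x ] Inverse.to α x ≢ x)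

  -- With n = p^r · k and p ∤ k: the Sylow p-subgroup C_{p^r} = {x | p^r·x = 0}
  -- and the product of the other Sylow subgroups is {x | k·x = 0}.
  -- α lies in Aut(C_{p^r}) (extended to C_n as in the context) iff α maps
  -- C_{p^r} into itself and fixes every element of the other Sylow factors.
  InSylowAut : (pr k : ℕ) → (Fin n ↔ Fin n) → Set
  InSylowAut pr k α =
    (∀ x → pr · x ≡ 𝟘 → pr · Inverse.to α x ≡ 𝟘) ×
    (∀ x → k · x ≡ 𝟘 → Inverse.to α x ≡ x)

module Submission where

-- An automorphism α of C_n = ℤ/n of odd prime order p that fixes every element killed by k is
-- multiplication by a = 1 + e with k ∣ e and a^p ≡ 1 (mod n). Fermat gives p ∣ e, and lifting the
-- exponent (p odd) gives m ∣ e for m = n/p, so α x = x (1 + u m) with p ∤ u; moreover p ∣ m.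
-- Hence the α-orbit of any d ∉ pC_n contains every translate d + i m, so S ∖ pC_n is invariant
-- under translation by ±m. The permutation σ that adds m to the multiples of p and fixes all other
-- vertices is then a digraph automorphism, but σ R(1) σ⁻¹ is no translation: it agrees with R(1)
-- at 1 (as 1, 2 ∉ pC_n) and differs from it at 0.

open import Defs
open import Data.Nat using (ℕ; _*_; _^_; _≤_; NonZero)
open import Data.Nat.Divisibility using (_∣_)
open import Data.Nat.Primality using (Prime)
open import Data.Fin using (Fin)
open import Data.Fin.Subset using (Subset; _∉_)
open import Data.Product using (∃-syntax; _×_)
open import Function.Bundles using (_↔_)
open import Relation.Nullary using (¬_)
open import Relation.Binary.PropositionalEquality using (_≡_)

open import Level using (0ℓ)
open import Algebra.Bundles using (AbelianGroup)
import Algebra.Properties.AbelianGroup as AbelianGroupProperties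
import Algebra.Properties.Group as GroupProperties
open import Data.Nat
open import Data.Nat.Properties
open import Data.Nat.Divisibility
open import Data.Nat.DivMod
open import Data.Nat.Primality
open import Data.Nat.Coprimality using (Coprime; coprime-Bézout)
open import Data.Nat.GCD using (module Bézout)
open import Data.Nat.Combinatorics
  using (_C_; nCk+nC[k+1]≡[n+1]C[k+1]; k>n⇒nCk≡0; nCn≡1; nCk≡n!/k![n-k]!; k![n∸k]!∣n!)
open import Data.Nat.Tactic.RingSolver
open import Data.Fin using (toℕ)
open import Data.Fin.Properties using (toℕ-fromℕ<; toℕ-injective; toℕ<n)
open import Data.Fin.Subset using (_∈_)
open import Data.Product
open import Data.Sum using (inj₁; inj₂)
open import Data.Empty using (⊥-elim)
open import Function using (_∘_; case_of_; it)
open import Function.Bundles using (_⇔_; Inverse; Equivalence; mk⇔; mk↔ₛ′)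
open import Relation.Nullary using (yes; no; contradiction)
open import Relation.Unary using (Decidable)
open import Relation.Binary.PropositionalEquality

binomialSum : ℕ → ℕ → ℕ → ℕ
binomialSum n x zero    = 0
binomialSum n x (suc k) = binomialSum n x k + (n C k) * x ^ k

binomialSum-pascal : ∀ n x k →
  binomialSum (suc n) x (suc k) ≡ binomialSum n x (suc k) + x * binomialSum n x k
binomialSum-pascal n x zero = cong (1 +_) (sym (*-zeroʳ x))
binomialSum-pascal n x (suc k) = begin
  binomialSum (suc n) x (suc k) + (suc n C suc k) * (x * x ^ k)
    ≡⟨ cong₂ (λ s c → s + c * (x * x ^ k))
         (binomialSum-pascal n x k) (sym (nCk+nC[k+1]≡[n+1]C[k+1] n k)) ⟩
  B₁ + x * B₀ + (n C k + n C suc k) * (x * x ^ k)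
    ≡⟨ rearrange B₁ B₀ (n C k) (n C suc k) x (x ^ k) ⟩
  (B₁ + (n C suc k) * (x * x ^ k)) + x * (B₀ + (n C k) * x ^ k) ∎
  where
  open ≡-Reasoning
  B₀ = binomialSum n x k
  B₁ = binomialSum n x (suc k)
  rearrange : ∀ b₁ b₀ c₀ c₁ x y →
    b₁ + x * b₀ + (c₀ + c₁) * (x * y) ≡ (b₁ + c₁ * (x * y)) + x * (b₀ + c₀ * y)
  rearrange = solve-∀

binomial-theorem : ∀ n x → (1 + x) ^ n ≡ binomialSum n x (suc n)
binomial-theorem zero    x = refl
binomial-theorem (suc n) x = begin
  (1 + x) * (1 + x) ^ n                ≡⟨ cong ((1 + x) *_) (binomial-theorem n x) ⟩
  B + x * B                            ≡⟨ cong (_+ x * B) (sym (+-identityʳ B)) ⟩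
  B + 0 * x ^ suc n + x * B            ≡⟨ cong (λ c → B + c * x ^ suc n + x * B)
                                               (sym (k>n⇒nCk≡0 (n<1+n n))) ⟩
  B + (n C suc n) * x ^ suc n + x * B  ≡⟨ sym (binomialSum-pascal n x (suc n)) ⟩
  binomialSum (suc n) x (suc (suc n))  ∎
  where
  open ≡-Reasoning
  B = binomialSum n x (suc n)

C*factorials≡factorial : ∀ {n k} → k ≤ n → (n C k) * (k ! * (n ∸ k) !) ≡ n !
C*factorials≡factorial {n} {k} k≤n = begin
  (n C k) * (k ! * (n ∸ k) !)                  ≡⟨ cong (_* (k ! * (n ∸ k) !)) (nCk≡n!/k![n-k]! k≤n) ⟩
  n ! / (k ! * (n ∸ k) !) * (k ! * (n ∸ k) !)  ≡⟨ m/n*n≡m (k![n∸k]!∣n! k≤n) ⟩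
  n !                                          ∎
  where
  open ≡-Reasoning
  instance _ = k !* (n ∸ k) !≢0

prime∤! : ∀ {p m} → Prime p → m < p → ¬ p ∣ m !
prime∤! {p} {zero} pr _ p∣1 = <⇒≱ (nonTrivial⇒n>1 p {{prime⇒nonTrivial pr}}) (∣⇒≤ p∣1)
prime∤! {p} {suc m} pr m<p p∣m! with euclidsLemma (suc m) (m !) pr p∣m!
... | inj₁ p∣1+m = <⇒≱ m<p (∣⇒≤ p∣1+m)
... | inj₂ p∣m!  = prime∤! pr (<-trans (n<1+n m) m<p) p∣m!

prime∣C : ∀ {p k} → Prime p → 0 < k → k < p → p ∣ p C k
prime∣C {suc p′} {k} pr 0<k k<p
  with euclidsLemma (suc p′ C k) (k ! * (suc p′ ∸ k) !) pr p∣C*factorials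
  where
  p∣C*factorials : suc p′ ∣ (suc p′ C k) * (k ! * (suc p′ ∸ k) !)
  p∣C*factorials = subst (suc p′ ∣_) (sym (C*factorials≡factorial (<⇒≤ k<p))) (m∣m*n (p′ !))
... | inj₁ p∣C = p∣C
... | inj₂ p∣factorials with euclidsLemma (k !) ((suc p′ ∸ k) !) pr p∣factorials
...   | inj₁ p∣k!   = ⊥-elim (prime∤! pr k<p p∣k!)
...   | inj₂ p∣p-k! = ⊥-elim (prime∤! pr (∸-monoʳ-< 0<k (<⇒≤ k<p)) p∣p-k!)

binomialSum-≡1-mod-prime : ∀ {p} x → Prime p → ∀ {k} → 0 < k → k ≤ p →
  ∃[ q ] binomialSum p x k ≡ 1 + q * p
binomialSum-≡1-mod-prime x pr {1} _ _ = 0 , refl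
binomialSum-≡1-mod-prime {p} x pr {suc (suc j)} _ k≤p
  with binomialSum-≡1-mod-prime x pr {suc j} z<s (<⇒≤ k≤p) | prime∣C pr z<s k≤p
... | q , eq | divides c C≡cp = q + c * x ^ suc j , (begin
  binomialSum p x (suc j) + (p C suc j) * x ^ suc j  ≡⟨ cong₂ (λ b d → b + d * x ^ suc j) eq C≡cp ⟩
  1 + q * p + c * p * x ^ suc j                       ≡⟨ collect q c p (x ^ suc j) ⟩
  1 + (q + c * x ^ suc j) * p                         ∎)
  where
  open ≡-Reasoning
  collect : ∀ q c p y → 1 + q * p + c * p * y ≡ 1 + (q + c * y) * p
  collect = solve-∀

freshman's-dream : ∀ {p} → Prime p → ∀ x → ∃[ q ] (1 + x) ^ p ≡ 1 + x ^ p + q * p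
freshman's-dream {p} pr x
  with binomialSum-≡1-mod-prime x pr (>-nonZero⁻¹ p {{prime⇒nonZero pr}}) ≤-refl
... | q , eq = q , (begin
  (1 + x) ^ p                                ≡⟨ binomial-theorem p x ⟩
  binomialSum p x p + (p C p) * x ^ p        ≡⟨ cong₂ (λ b c → b + c * x ^ p) eq (nCn≡1 p) ⟩
  1 + q * p + 1 * x ^ p                      ≡⟨ reorder q p (x ^ p) ⟩
  1 + x ^ p + q * p                          ∎)
  where
  open ≡-Reasoning
  reorder : ∀ q p y → 1 + q * p + 1 * y ≡ 1 + y + q * p
  reorder = solve-∀

prime⇒≡2+ : ∀ {p} → Prime p → ∃[ o ] 2 + o ≡ p
prime⇒≡2+ {p} pr = m≤n⇒∃[o]m+o≡n (nonTrivial⇒n>1 p {{prime⇒nonTrivial pr}})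

fermat : ∀ {p} → Prime p → ∀ x → ∃[ q ] x ^ p ≡ x + q * p
fermat pr zero with prime⇒≡2+ pr
... | _ , refl = 0 , refl
fermat {p} pr (suc x) with freshman's-dream pr x | fermat pr x
... | q₁ , eq₁ | q₂ , eq₂ = q₂ + q₁ , (begin
  (1 + x) ^ p                ≡⟨ eq₁ ⟩
  1 + x ^ p + q₁ * p         ≡⟨ cong (λ y → 1 + y + q₁ * p) eq₂ ⟩
  1 + (x + q₂ * p) + q₁ * p  ≡⟨ collect x q₁ q₂ p ⟩
  suc x + (q₂ + q₁) * p      ∎)
  where
  open ≡-Reasoning
  collect : ∀ x q₁ q₂ p → 1 + (x + q₂ * p) + q₁ * p ≡ suc x + (q₂ + q₁) * p
  collect = solve-∀

odd⇒≡1+2* : ∀ p → ¬ 2 ∣ p → ∃[ q ] p ≡ 1 + 2 * q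
odd⇒≡1+2* zero          2∤p = ⊥-elim (2∤p (2 ∣0))
odd⇒≡1+2* (suc zero)    _   = 0 , refl
odd⇒≡1+2* (suc (suc p)) 2∤p with odd⇒≡1+2* p (2∤p ∘ ∣m∣n⇒∣m+n ∣-refl)
... | q , refl = suc q , cong (2 +_) (sym (+-suc q (q + 0)))

-- The coefficient of x² is (p choose 2) = p q for p = 1 + 2 q.
odd-power-expansion : ∀ q x →
  ∃[ R ] (1 + x) ^ (1 + 2 * q) ≡ 1 + (1 + 2 * q) * x * (1 + q * x) + x * x * x * R
odd-power-expansion zero    x = 0 , base x
  where
  base : ∀ x → (1 + x) * 1 ≡ 1 + 1 * x * (1 + 0 * x) + x * x * x * 0
  base = solve-∀
odd-power-expansion (suc q) x with odd-power-expansion q x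
... | R , eq = R′ , (begin
  (1 + x) ^ (1 + 2 * suc q)                     ≡⟨ cong (λ e → (1 + x) ^ suc e) (*-suc 2 q) ⟩
  (1 + x) * ((1 + x) * (1 + x) ^ (1 + 2 * q))   ≡⟨ cong (λ y → (1 + x) * ((1 + x) * y)) eq ⟩
  (1 + x) * ((1 + x) * (1 + (1 + 2 * q) * x * (1 + q * x) + x * x * x * R))
                                                ≡⟨ step q x R ⟩
  1 + (1 + 2 * suc q) * x * (1 + suc q * x) + x * x * x * R′ ∎)
  where
  open ≡-Reasoning
  R′ = R + 2 * (1 + 2 * q) * q + (1 + 2 * q) + 2 * x * R + (1 + 2 * q) * q * x + x * x * R
  step : ∀ q x R →
    (1 + x) * ((1 + x) * (1 + (1 + 2 * q) * x * (1 + q * x) + x * x * x * R))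
    ≡ 1 + (1 + 2 * (1 + q)) * x * (1 + (1 + q) * x)
      + x * x * x * (R + 2 * (1 + 2 * q) * q + (1 + 2 * q) + 2 * x * R + (1 + 2 * q) * q * x + x * x * R)
  step = solve-∀

-- In N = p e (1 + q e) + e³ R every term but p e is divisible by p^(3+j).
lift-exponent-step : ∀ {p} .{{_ : NonZero p}} q j {e R} →
  p ^ (3 + j) ∣ p * e * (1 + q * e) + e * e * e * R → p ^ (1 + j) ∣ e → p ^ (2 + j) ∣ e
lift-exponent-step {p} q j {R = R} p³⁺ʲ∣N (divides c refl) =
  *-cancelˡ-∣ p (∣m+n∣m⇒∣n (subst (p ^ (3 + j) ∣_) (split p q c (p ^ j) R) p³⁺ʲ∣N) p³⁺ʲ∣rest)
  where
  e = c * (p * p ^ j)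
  p³⁺ʲ∣rest : p ^ (3 + j) ∣ p * e * (q * e) + e * e * e * R
  p³⁺ʲ∣rest = divides (q * c * c * p ^ j + c * c * c * p ^ j * p ^ j * R) (factor p q c (p ^ j) R)
    where
    factor : ∀ p q c X R →
      p * (c * (p * X)) * (q * (c * (p * X))) + c * (p * X) * (c * (p * X)) * (c * (p * X)) * R
      ≡ (q * c * c * X + c * c * c * X * X * R) * (p * (p * (p * X)))
    factor = solve-∀
  split : ∀ p q c X R →
    p * (c * (p * X)) * (1 + q * (c * (p * X))) + c * (p * X) * (c * (p * X)) * (c * (p * X)) * R
    ≡ p * (c * (p * X)) * (q * (c * (p * X))) + c * (p * X) * (c * (p * X)) * (c * (p * X)) * R
      + p * (c * (p * X))
  split = solve-∀

lift-exponent : ∀ {p} .{{_ : NonZero p}} q r {e R} →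
  p ∣ e → p ^ suc r ∣ p * e * (1 + q * e) + e * e * e * R → p ^ r ∣ e
lift-exponent     q zero          {e} _   _     = 1∣ e
lift-exponent {p} q (suc zero)    {e} p∣e _     = subst (_∣ e) (sym (*-identityʳ p)) p∣e
lift-exponent {p} q (suc (suc j))     p∣e p^r∣N =
  lift-exponent-step q j p^r∣N (lift-exponent q (suc j) p∣e (∣-trans (n∣m*n p) p^r∣N))

prime-power-divisor : ∀ {p k} → Prime p → ¬ p ∣ k → ∀ r {c} → p ^ r ∣ k * c → p ^ r ∣ c
prime-power-divisor pr p∤k zero {c} _ = 1∣ c
prime-power-divisor {p} {k} pr p∤k (suc r) {c} p^r∣kc
  with euclidsLemma k c pr (∣-trans (m∣m*n (p ^ r)) p^r∣kc)
... | inj₁ p∣k = ⊥-elim (p∤k p∣k)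
... | inj₂ (divides c′ refl) =
  subst (p * p ^ r ∣_) (*-comm p c′) (*-monoʳ-∣ p (prime-power-divisor pr p∤k r p^r∣kc′))
  where
  instance _ = prime⇒nonZero pr
  p^r∣kc′ : p ^ r ∣ k * c′
  p^r∣kc′ = *-cancelˡ-∣ p (subst (p * p ^ r ∣_) (trans (sym (*-assoc k c′ p)) (*-comm (k * c′) p))
                                p^r∣kc)

inverse-mod-prime : ∀ {p c} → Prime p → ¬ p ∣ c → ∃[ j ] ∃[ q ] j * c ≡ 1 + q * p
inverse-mod-prime {p} {c} pr p∤c with coprime-Bézout coprime | prime⇒≡2+ pr
  where
  coprime : Coprime p c
  coprime (d∣p , d∣c) with prime⇒irreducible pr d∣p
  ... | inj₁ d≡1 = d≡1
  ... | inj₂ refl = ⊥-elim (p∤c d∣c)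
... | Bézout.-+ x y eq       | _         = y , x , sym eq
-- From 1 + y c = x p it follows that (p − 1) y c = (p − 1)(x p − 1) ≡ 1 (mod p).
... | Bézout.+- (suc x) y eq | p″ , refl =
  suc p″ * y , p″ + suc p″ * x , +-cancelˡ-≡ (suc p″) _ _ (begin
    suc p″ + suc p″ * y * c                      ≡⟨ distrib p″ y c ⟩
    suc p″ * (1 + y * c)                         ≡⟨ cong (suc p″ *_) eq ⟩
    suc p″ * (suc x * (2 + p″))                  ≡⟨ regroup p″ x ⟩
    suc p″ + (1 + (p″ + suc p″ * x) * (2 + p″))  ∎)
  where
  open ≡-Reasoning
  distrib : ∀ p″ y c → suc p″ + suc p″ * y * c ≡ suc p″ * (1 + y * c)
  distrib = solve-∀
  regroup : ∀ p″ x → suc p″ * (suc x * (2 + p″)) ≡ suc p″ + (1 + (p″ + suc p″ * x) * (2 + p″))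
  regroup = solve-∀

fermat-∣ : ∀ {p e N} → Prime p → (1 + e) ^ p ≡ 1 + N → p ∣ N → p ∣ e
fermat-∣ {p} {e} {N} pr eq p∣N with fermat pr (1 + e)
... | q , eq′ = ∣m+n∣m⇒∣n (subst (p ∣_) N≡qp+e p∣N) (n∣m*n q)
  where
  N≡qp+e : N ≡ q * p + e
  N≡qp+e = suc-injective (trans (sym eq) (trans eq′ (cong suc (+-comm e (q * p)))))

order-p-unit : ∀ {p k e N} r → Prime p → ¬ 2 ∣ p → ¬ p ∣ k → k ∣ e →
  (1 + e) ^ p ≡ 1 + N → p ^ suc r * k ∣ N → p ∣ e × p ^ r * k ∣ e
order-p-unit {p} {k} {e} {N} r pr 2∤p p∤k (divides c refl) eq n∣N
  with odd⇒≡1+2* p 2∤p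
... | q , refl with odd-power-expansion q e
... | R , expansion =
  p∣e , *-monoˡ-∣ k (prime-power-divisor pr p∤k r (subst (p ^ r ∣_) (*-comm c k) p^r∣e))
  where
  instance _ = prime⇒nonZero pr
  p∣e : p ∣ e
  p∣e = fermat-∣ pr eq (∣-trans (∣m⇒∣m*n k (m∣m*n (p ^ r))) n∣N)
  p^r∣e : p ^ r ∣ e
  p^r∣e = lift-exponent q r p∣e (subst (p ^ suc r ∣_) (suc-injective (trans (sym eq) expansion))
                                       (∣-trans (m∣m*n k) n∣N))

module _ {n : ℕ} .{{_ : NonZero n}} where

  0%n≡0 : 0 % n ≡ 0
  0%n≡0 = m<n⇒m%n≡m (>-nonZero⁻¹ n)

  ⟦_⟧ : ℕ → Fin n
  ⟦ t ⟧ = t mod n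

  toℕ-⟦⟧ : ∀ t → toℕ ⟦ t ⟧ ≡ t % n
  toℕ-⟦⟧ t = toℕ-fromℕ< (m%n<n t n)

  ⟦⟧-toℕ : ∀ x → ⟦ toℕ x ⟧ ≡ x
  ⟦⟧-toℕ x = toℕ-injective (trans (toℕ-⟦⟧ (toℕ x)) (m<n⇒m%n≡m (toℕ<n x)))

  %≡⇒⟦⟧≡ : ∀ {a b} → a % n ≡ b % n → ⟦ a ⟧ ≡ ⟦ b ⟧
  %≡⇒⟦⟧≡ {a} {b} eq = toℕ-injective (trans (toℕ-⟦⟧ a) (trans eq (sym (toℕ-⟦⟧ b))))

  ⟦⟧≡⇒%≡ : ∀ {a b} → ⟦ a ⟧ ≡ ⟦ b ⟧ → a % n ≡ b % n
  ⟦⟧≡⇒%≡ {a} {b} eq = trans (sym (toℕ-⟦⟧ a)) (trans (cong toℕ eq) (toℕ-⟦⟧ b))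

  ⟦⟧-+ : ∀ a b → ⟦ a + b ⟧ ≡ ⟦ a ⟧ ⊕ ⟦ b ⟧
  ⟦⟧-+ a b = %≡⇒⟦⟧≡ (trans (%-distribˡ-+ a b n)
                             (cong₂ (λ u v → (u + v) % n) (sym (toℕ-⟦⟧ a)) (sym (toℕ-⟦⟧ b))))

  ⟦⟧-* : ∀ a b → ⟦ a * b ⟧ ≡ a · ⟦ b ⟧
  ⟦⟧-* a b = %≡⇒⟦⟧≡ (begin
    (a * b) % n                    ≡⟨ %-distribˡ-* a b n ⟩
    (a % n * (b % n)) % n          ≡⟨ cong (λ v → (a % n * v) % n) (sym (m%n%n≡m%n b n)) ⟩
    (a % n * (b % n % n)) % n      ≡⟨ sym (%-distribˡ-* a (b % n) n) ⟩
    (a * (b % n)) % n              ≡⟨ cong (λ v → (a * v) % n) (sym (toℕ-⟦⟧ b)) ⟩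
    (a * toℕ ⟦ b ⟧) % n            ∎)
    where open ≡-Reasoning

  ∣⇒⟦⟧≡𝟘 : ∀ {a} → n ∣ a → ⟦ a ⟧ ≡ 𝟘
  ∣⇒⟦⟧≡𝟘 {a} n∣a = %≡⇒⟦⟧≡ (trans (n∣m⇒m%n≡0 a n n∣a) (sym 0%n≡0))

  ⟦⟧≡𝟘⇒∣ : ∀ {a} → ⟦ a ⟧ ≡ 𝟘 → n ∣ a
  ⟦⟧≡𝟘⇒∣ {a} eq = m%n≡0⇒n∣m a n (trans (⟦⟧≡⇒%≡ eq) 0%n≡0)

  infix 25 ⊖_
  ⊖_ : Fin n → Fin n
  ⊖ x = ⟦ n ∸ toℕ x ⟧

  ⊕-comm : ∀ x y → x ⊕ y ≡ y ⊕ x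
  ⊕-comm x y = cong ⟦_⟧ (+-comm (toℕ x) (toℕ y))

  ⊕-assoc : ∀ x y z → (x ⊕ y) ⊕ z ≡ x ⊕ (y ⊕ z)
  ⊕-assoc x y z = begin
    ⟦ X + Y ⟧ ⊕ z                   ≡⟨ cong (⟦ X + Y ⟧ ⊕_) (sym (⟦⟧-toℕ z)) ⟩
    ⟦ X + Y ⟧ ⊕ ⟦ Z ⟧               ≡⟨ sym (⟦⟧-+ (X + Y) Z) ⟩
    ⟦ X + Y + Z ⟧                   ≡⟨ cong ⟦_⟧ (+-assoc X Y Z) ⟩
    ⟦ X + (Y + Z) ⟧                 ≡⟨ ⟦⟧-+ X (Y + Z) ⟩
    ⟦ X ⟧ ⊕ (y ⊕ z)                 ≡⟨ cong (_⊕ (y ⊕ z)) (⟦⟧-toℕ x) ⟩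
    x ⊕ (y ⊕ z)                     ∎
    where
    open ≡-Reasoning
    X = toℕ x
    Y = toℕ y
    Z = toℕ z

  ⊕-identityˡ : ∀ x → 𝟘 ⊕ x ≡ x
  ⊕-identityˡ x = trans (cong (λ v → ⟦ v + toℕ x ⟧) (trans (toℕ-⟦⟧ 0) 0%n≡0)) (⟦⟧-toℕ x)

  ⊕-inverseʳ : ∀ x → x ⊕ ⊖ x ≡ 𝟘
  ⊕-inverseʳ x = begin
    x ⊕ ⊖ x                         ≡⟨ cong (_⊕ ⊖ x) (sym (⟦⟧-toℕ x)) ⟩
    ⟦ toℕ x ⟧ ⊕ ⟦ n ∸ toℕ x ⟧       ≡⟨ sym (⟦⟧-+ (toℕ x) (n ∸ toℕ x)) ⟩
    ⟦ toℕ x + (n ∸ toℕ x) ⟧         ≡⟨ cong ⟦_⟧ (m+[n∸m]≡n (<⇒≤ (toℕ<n x))) ⟩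
    ⟦ n ⟧                           ≡⟨ ∣⇒⟦⟧≡𝟘 ∣-refl ⟩
    𝟘                               ∎
    where open ≡-Reasoning

  ⊕-abelianGroup : AbelianGroup 0ℓ 0ℓ
  ⊕-abelianGroup = record
    { Carrier = Fin n ; _≈_ = _≡_ ; _∙_ = _⊕_ ; ε = 𝟘 ; _⁻¹ = ⊖_
    ; isAbelianGroup = record
      { isGroup = record
        { isMonoid = record
          { isSemigroup = record
            { isMagma = record { isEquivalence = isEquivalence ; ∙-cong = cong₂ _⊕_ }
            ; assoc = ⊕-assoc }
          ; identity = ⊕-identityˡ , λ x → trans (⊕-comm x 𝟘) (⊕-identityˡ x) }
        ; inverse = (λ x → trans (⊕-comm (⊖ x) x) (⊕-inverseʳ x)) , ⊕-inverseʳ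
        ; ⁻¹-cong = cong ⊖_ }
      ; comm = ⊕-comm } }

  ⟦⟧-remove-+ʳ : ∀ a {b} → n ∣ b → ⟦ a + b ⟧ ≡ ⟦ a ⟧
  ⟦⟧-remove-+ʳ a n∣b = %≡⇒⟦⟧≡ (%-remove-+ʳ a n∣b)

  [a+b]%n≡a%n⇒n∣b : ∀ a b → (a + b) % n ≡ a % n → n ∣ b
  [a+b]%n≡a%n⇒n∣b a b eq =
    ⟦⟧≡𝟘⇒∣ (identityʳ-unique ⟦ a ⟧ ⟦ b ⟧ (trans (sym (⟦⟧-+ a b)) (%≡⇒⟦⟧≡ eq)))
    where open GroupProperties (AbelianGroup.group ⊕-abelianGroup) using (identityʳ-unique)

  ⊖⟦⟧≡⟦⟧ : ∀ a b → a + b ≡ n → ⊖ ⟦ a ⟧ ≡ ⟦ b ⟧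
  ⊖⟦⟧≡⟦⟧ a b a+b≡n =
    sym (inverseʳ-unique ⟦ a ⟧ ⟦ b ⟧ (trans (sym (⟦⟧-+ a b)) (∣⇒⟦⟧≡𝟘 (∣-reflexive (sym a+b≡n)))))
    where open GroupProperties (AbelianGroup.group ⊕-abelianGroup) using (inverseʳ-unique)

  ⟦⟧≢𝟘 : ∀ {a} → 0 < a → a < n → ⟦ a ⟧ ≢ 𝟘
  ⟦⟧≢𝟘 {a} 0<a a<n ⟦a⟧≡𝟘 = <⇒≱ a<n (∣⇒≤ {{>-nonZero 0<a}} (⟦⟧≡𝟘⇒∣ ⟦a⟧≡𝟘))

order-p-multiplier : ∀ {n p k a} r .{{_ : NonZero n}} → Prime p → ¬ 2 ∣ p → ¬ p ∣ k →
  n ≡ p ^ suc r * k → a < n → a ^ p % n ≡ 1 % n → p ^ suc r * a % n ≡ p ^ suc r % n → a ≢ 1 →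
  ∃[ u ] ¬ p ∣ u × p ∣ p ^ r * k × a ≡ 1 + u * (p ^ r * k)
-- Once p is seen to be 2 + o, 0 ^ p reduces to 0, so a^p≡1 says 0 ≡ 1 (mod n).
order-p-multiplier {n} {p} {k} {zero} r pr _ _ refl _ a^p≡1 _ _ with prime⇒≡2+ pr
... | _ , refl = ⊥-elim (<⇒≱ (nonTrivial⇒n>1 p {{prime⇒nonTrivial pr}}) (∣⇒≤ p∣1))
  where
  p∣1 : p ∣ 1
  p∣1 = ∣-trans (∣m⇒∣m*n k (m∣m*n (p ^ r))) ([a+b]%n≡a%n⇒n∣b 0 1 (sym a^p≡1))
order-p-multiplier {n} {p} {k} {suc e} r pr 2∤p p∤k refl a<n a^p≡1 Pa≡P a≢1
  with order-p-unit r pr 2∤p p∤k k∣e (sym (suc-pred ((1 + e) ^ p))) n∣N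
  where
  instance
    _ = prime⇒nonZero pr
    _ = m^n≢0 (1 + e) p
    _ = m^n≢0 p (suc r)
  n∣N : n ∣ pred ((1 + e) ^ p)
  n∣N = [a+b]%n≡a%n⇒n∣b 1 _ (trans (cong (_% n) (suc-pred ((1 + e) ^ p))) a^p≡1)
  k∣e : k ∣ e
  k∣e = *-cancelˡ-∣ (p ^ suc r)
          ([a+b]%n≡a%n⇒n∣b (p ^ suc r) _ (trans (cong (_% n) (sym (*-suc (p ^ suc r) e))) Pa≡P))
... | p∣e , m∣e = u , p∤u , p∣m , cong suc e≡um
  where
  m = p ^ r * k
  u = quotient m∣e
  e≡um : e ≡ u * m
  e≡um = m∣n⇒n≡quotient*m m∣e
  u<p : u < p
  u<p = *-cancelʳ-< m u p (subst₂ _<_ e≡um (*-assoc p (p ^ r) k) (<-trans (n<1+n e) a<n))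
  u≢0 : u ≢ 0
  u≢0 u≡0 = a≢1 (cong suc (trans e≡um (cong (_* m) u≡0)))
  p∤u : ¬ p ∣ u
  p∤u p∣u = <⇒≱ u<p (∣⇒≤ {{≢-nonZero u≢0}} p∣u)
  p∣m : p ∣ m
  p∣m with euclidsLemma u m pr (subst (p ∣_) e≡um p∣e)
  ... | inj₁ p∣u = ⊥-elim (p∤u p∣u)
  ... | inj₂ p∣m = p∣m

module _ {n : ℕ} .{{_ : NonZero n}} (f : Fin n → Fin n) where

  endomorphism-⟦⟧ : (∀ x y → f (x ⊕ y) ≡ f x ⊕ f y) → ∀ t → f ⟦ t ⟧ ≡ ⟦ t * toℕ (f ⟦ 1 ⟧) ⟧
  endomorphism-⟦⟧ hom zero = identityʳ-unique (f 𝟘) (f 𝟘) (trans (sym (hom 𝟘 𝟘)) (cong f (identityˡ 𝟘)))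
    where open AbelianGroup (⊕-abelianGroup {n}) using (identityˡ; group)
          open GroupProperties group using (identityʳ-unique)
  endomorphism-⟦⟧ hom (suc t) = begin
    f ⟦ 1 + t ⟧                   ≡⟨ cong f (⟦⟧-+ 1 t) ⟩
    f (⟦ 1 ⟧ ⊕ ⟦ t ⟧)             ≡⟨ hom ⟦ 1 ⟧ ⟦ t ⟧ ⟩
    f ⟦ 1 ⟧ ⊕ f ⟦ t ⟧             ≡⟨ cong₂ _⊕_ (sym (⟦⟧-toℕ (f ⟦ 1 ⟧))) (endomorphism-⟦⟧ hom t) ⟩
    ⟦ a ⟧ ⊕ ⟦ t * a ⟧             ≡⟨ sym (⟦⟧-+ a (t * a)) ⟩
    ⟦ a + t * a ⟧                 ∎
    where
    open ≡-Reasoning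
    a = toℕ (f ⟦ 1 ⟧)

  iter-multiplication : ∀ {a} → (∀ t → f ⟦ t ⟧ ≡ ⟦ t * a ⟧) → ∀ j t → iter j f ⟦ t ⟧ ≡ ⟦ t * a ^ j ⟧
  iter-multiplication mult zero    t = cong ⟦_⟧ (sym (*-identityʳ t))
  iter-multiplication {a} mult (suc j) t = begin
    f (iter j f ⟦ t ⟧)     ≡⟨ cong f (iter-multiplication mult j t) ⟩
    f ⟦ t * a ^ j ⟧        ≡⟨ mult (t * a ^ j) ⟩
    ⟦ t * a ^ j * a ⟧      ≡⟨ cong ⟦_⟧ (reorder t a (a ^ j)) ⟩
    ⟦ t * (a * a ^ j) ⟧    ∎
    where
    open ≡-Reasoning
    reorder : ∀ t a y → t * y * a ≡ t * (a * y)
    reorder = solve-∀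

  iter-unipotent : ∀ {m u} → n ∣ m * m → (∀ t → f ⟦ t ⟧ ≡ ⟦ t * (1 + u * m) ⟧) →
    ∀ j t → iter j f ⟦ t ⟧ ≡ ⟦ t + j * (t * u) * m ⟧
  iter-unipotent n∣m² mult zero    t = cong ⟦_⟧ (sym (+-identityʳ t))
  iter-unipotent {m} {u} n∣m² mult (suc j) t = begin
    f (iter j f ⟦ t ⟧)                                     ≡⟨ cong f (iter-unipotent n∣m² mult j t) ⟩
    f ⟦ t + j * (t * u) * m ⟧                              ≡⟨ mult _ ⟩
    ⟦ (t + j * (t * u) * m) * (1 + u * m) ⟧                ≡⟨ cong ⟦_⟧ (expand t j u m) ⟩
    ⟦ t + suc j * (t * u) * m + j * t * u * u * (m * m) ⟧  ≡⟨ ⟦⟧-remove-+ʳ _ (∣n⇒∣m*n (j * t * u * u) n∣m²) ⟩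
    ⟦ t + suc j * (t * u) * m ⟧                            ∎
    where
    open ≡-Reasoning
    expand : ∀ t j u m → (t + j * (t * u) * m) * (1 + u * m)
                        ≡ t + suc j * (t * u) * m + j * t * u * u * (m * m)
    expand = solve-∀

  iter-preserves : ∀ {S : Subset n} → (∀ x → x ∈ S → f x ∈ S) → ∀ j {x} → x ∈ S → iter j f x ∈ S
  iter-preserves f-pres zero    x∈S = x∈S
  iter-preserves f-pres (suc j) x∈S = f-pres _ (iter-preserves f-pres j x∈S)

  orbit-translates : ∀ {p m u} → Prime p → n ≡ p * m → p ∣ m → ¬ p ∣ u →
    (∀ t → f ⟦ t ⟧ ≡ ⟦ t * (1 + u * m) ⟧) →
    ∀ d → ¬ p ∣ toℕ d → ∀ i → ∃[ j ] iter j f d ≡ d ⊕ ⟦ i * m ⟧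
  orbit-translates {p} {m} {u} pr n≡pm p∣m p∤u mult d p∤d i
    with inverse-mod-prime pr p∤du
    where
    p∤du : ¬ p ∣ toℕ d * u
    p∤du p∣du with euclidsLemma (toℕ d) u pr p∣du
    ... | inj₁ p∣d = p∤d p∣d
    ... | inj₂ p∣u = p∤u p∣u
  ... | j₀ , q , j₀du≡1+qp = i * j₀ , (begin
    iter (i * j₀) f d                   ≡⟨ cong (iter (i * j₀) f) (sym (⟦⟧-toℕ d)) ⟩
    iter (i * j₀) f ⟦ t ⟧               ≡⟨ iter-unipotent n∣m² mult (i * j₀) t ⟩
    ⟦ t + i * j₀ * (t * u) * m ⟧        ≡⟨ cong (λ z → ⟦ t + z * m ⟧) (*-assoc i j₀ (t * u)) ⟩
    ⟦ t + i * (j₀ * (t * u)) * m ⟧      ≡⟨ cong (λ z → ⟦ t + i * z * m ⟧) j₀du≡1+qp ⟩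
    ⟦ t + i * (1 + q * p) * m ⟧         ≡⟨ cong ⟦_⟧ (expand t i q p m) ⟩
    ⟦ t + i * m + i * q * (p * m) ⟧     ≡⟨ ⟦⟧-remove-+ʳ _ (∣n⇒∣m*n (i * q) (∣-reflexive n≡pm)) ⟩
    ⟦ t + i * m ⟧                       ≡⟨ ⟦⟧-+ t (i * m) ⟩
    ⟦ t ⟧ ⊕ ⟦ i * m ⟧                   ≡⟨ cong (_⊕ ⟦ i * m ⟧) (⟦⟧-toℕ d) ⟩
    d ⊕ ⟦ i * m ⟧                       ∎)
    where
    open ≡-Reasoning
    t = toℕ d
    n∣m² : n ∣ m * m
    n∣m² = subst (_∣ m * m) (sym n≡pm) (*-monoˡ-∣ m p∣m)
    expand : ∀ t i q p m → t + i * (1 + q * p) * m ≡ t + i * m + i * q * (p * m)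
    expand = solve-∀

module _ {n : ℕ} .{{_ : NonZero n}} (α : Fin n ↔ Fin n) where

  private
    f = Inverse.to α

  order-p-automorphism : ∀ {p k} r → Prime p → ¬ 2 ∣ p → ¬ p ∣ k → n ≡ p ^ suc r * k →
    IsGroupAut α → HasPrimeOrder p α → InSylowAut (p ^ suc r) k α →
    ∃[ u ] ¬ p ∣ u × p ∣ p ^ r * k × ∀ t → f ⟦ t ⟧ ≡ ⟦ t * (1 + u * (p ^ r * k)) ⟧
  order-p-automorphism {p} {k} r pr 2∤p p∤k n≡ hom (α^p≡id , x , αx≢x) (_ , fixes-k-part)
    with order-p-multiplier r pr 2∤p p∤k n≡ (toℕ<n (f ⟦ 1 ⟧)) a^p≡1 Pa≡P a≢1
    where
    a = toℕ (f ⟦ 1 ⟧)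
    P = p ^ suc r
    mult : ∀ t → f ⟦ t ⟧ ≡ ⟦ t * a ⟧
    mult = endomorphism-⟦⟧ f hom
    a^p≡1 : a ^ p % n ≡ 1 % n
    a^p≡1 = ⟦⟧≡⇒%≡ (trans (cong ⟦_⟧ (sym (*-identityˡ (a ^ p))))
                   (trans (sym (iter-multiplication f mult p 1)) (α^p≡id ⟦ 1 ⟧)))
    Pa≡P : P * a % n ≡ P % n
    Pa≡P = ⟦⟧≡⇒%≡ (trans (sym (mult P)) (fixes-k-part ⟦ P ⟧ k·P≡𝟘))
      where
      k·P≡𝟘 : k · ⟦ P ⟧ ≡ 𝟘
      k·P≡𝟘 = trans (sym (⟦⟧-* k P)) (∣⇒⟦⟧≡𝟘 (∣-reflexive (trans n≡ (*-comm P k))))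
    a≢1 : a ≢ 1
    a≢1 a≡1 = αx≢x (begin
      f x                   ≡⟨ cong f (sym (⟦⟧-toℕ x)) ⟩
      f ⟦ toℕ x ⟧           ≡⟨ mult (toℕ x) ⟩
      ⟦ toℕ x * a ⟧         ≡⟨ cong (λ b → ⟦ toℕ x * b ⟧) a≡1 ⟩
      ⟦ toℕ x * 1 ⟧         ≡⟨ cong ⟦_⟧ (*-identityʳ (toℕ x)) ⟩
      ⟦ toℕ x ⟧             ≡⟨ ⟦⟧-toℕ x ⟩
      x                     ∎)
      where open ≡-Reasoning
  ... | u , p∤u , p∣m , a≡1+um =
    u , p∤u , p∣m , λ t → trans (endomorphism-⟦⟧ f hom t) (cong (λ b → ⟦ t * b ⟧) a≡1+um)

-- H is a decidable subgroup of C_n, given through the coset property of its membership.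
module Switch {n : ℕ} .{{_ : NonZero n}}
  (H : Fin n → Set) (H? : Decidable H)
  (H-coset : ∀ {x} y → H x → H (y ⊕ x) ⇔ H y) where

  open AbelianGroup (⊕-abelianGroup {n})
    using (assoc; comm; identityˡ; identityʳ; inverseˡ; inverseʳ; group)
  open AbelianGroupProperties (⊕-abelianGroup {n}) using (xyx⁻¹≈y)
  open GroupProperties group using (ε⁻¹≈ε; ⁻¹-involutive; identityˡ-unique; ∙-cancelˡ)
  open ≡-Reasoning

  shift : Fin n → Fin n → Fin n
  shift c x with H? x
  ... | yes _ = c
  ... | no  _ = 𝟘

  switch : Fin n → Fin n → Fin n
  switch c x = x ⊕ shift c x

  switch-moves : ∀ c {x} → H x → switch c x ≡ x ⊕ c
  switch-moves c {x} Hx with H? x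
  ... | yes _  = refl
  ... | no ¬Hx = contradiction Hx ¬Hx

  switch-fixes : ∀ c {x} → ¬ H x → switch c x ≡ x
  switch-fixes c {x} ¬Hx with H? x
  ... | yes Hx = contradiction Hx ¬Hx
  ... | no _   = identityʳ x

  H-𝟘 : ∀ {c} → H c → H 𝟘
  H-𝟘 {c} Hc = Equivalence.to (H-coset 𝟘 Hc) (subst H (sym (identityˡ c)) Hc)

  H-⊖ : ∀ {c} → H c → H (⊖ c)
  H-⊖ {c} Hc = Equivalence.to (H-coset (⊖ c) Hc) (subst H (sym (inverseˡ c)) (H-𝟘 Hc))

  switch-inverse : ∀ {c} → H c → ∀ x → switch (⊖ c) (switch c x) ≡ x
  switch-inverse {c} Hc x = case H? x of λ where
    (no ¬Hx) → trans (cong (switch (⊖ c)) (switch-fixes c ¬Hx)) (switch-fixes (⊖ c) ¬Hx)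
    (yes Hx) → begin
      switch (⊖ c) (switch c x) ≡⟨ cong (switch (⊖ c)) (switch-moves c Hx) ⟩
      switch (⊖ c) (x ⊕ c)      ≡⟨ switch-moves (⊖ c) (Equivalence.from (H-coset x Hc) Hx) ⟩
      (x ⊕ c) ⊕ ⊖ c             ≡⟨ assoc x c (⊖ c) ⟩
      x ⊕ (c ⊕ ⊖ c)             ≡⟨ cong (x ⊕_) (inverseʳ c) ⟩
      x ⊕ 𝟘                     ≡⟨ identityʳ x ⟩
      x                         ∎

  switch-↔ : ∀ {c} → H c → Fin n ↔ Fin n
  switch-↔ {c} Hc = mk↔ₛ′ (switch c) (switch (⊖ c)) inverse (switch-inverse Hc)
    where
    inverse : ∀ y → switch c (switch (⊖ c) y) ≡ y
    inverse y = subst (λ c′ → switch c′ (switch (⊖ c) y) ≡ y) (⁻¹-involutive c)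
                      (switch-inverse (H-⊖ Hc) y)

  TranslationClosed : Subset n → Fin n → Set
  TranslationClosed S c = ∀ d → ¬ H d → d ∈ S → d ⊕ c ∈ S

  ⊕-rebalance : ∀ s x a b → (s ⊕ x) ⊕ b ≡ (s ⊕ (b ⊕ ⊖ a)) ⊕ (x ⊕ a)
  ⊕-rebalance s x a b = sym (begin
    (s ⊕ (b ⊕ ⊖ a)) ⊕ (x ⊕ a)   ≡⟨ assoc s (b ⊕ ⊖ a) (x ⊕ a) ⟩
    s ⊕ ((b ⊕ ⊖ a) ⊕ (x ⊕ a))   ≡⟨ cong (s ⊕_) (comm (b ⊕ ⊖ a) (x ⊕ a)) ⟩
    s ⊕ ((x ⊕ a) ⊕ (b ⊕ ⊖ a))   ≡⟨ cong (s ⊕_) (assoc x a (b ⊕ ⊖ a)) ⟩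
    s ⊕ (x ⊕ (a ⊕ (b ⊕ ⊖ a)))   ≡⟨ cong (λ z → s ⊕ (x ⊕ z)) (sym (assoc a b (⊖ a))) ⟩
    s ⊕ (x ⊕ ((a ⊕ b) ⊕ ⊖ a))   ≡⟨ cong (λ z → s ⊕ (x ⊕ z)) (xyx⁻¹≈y a b) ⟩
    s ⊕ (x ⊕ b)                 ≡⟨ sym (assoc s x b) ⟩
    (s ⊕ x) ⊕ b                 ∎)

  corrected-label∈S : ∀ {S c} → TranslationClosed S c → TranslationClosed S (⊖ c) →
    ∀ {s x y} → y ≡ s ⊕ x → s ∈ S → s ⊕ (shift c y ⊕ ⊖ shift c x) ∈ S
  corrected-label∈S {S} {c} closed closed⊖ {s} {x} {y} y≡s⊕x s∈S with H? x | H? y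
  ... | yes _  | yes _  = subst (_∈ S) (sym (trans (cong (s ⊕_) (inverseʳ c)) (identityʳ s))) s∈S
  ... | no _   | no _   = subst (_∈ S) (sym (trans (cong (s ⊕_) (inverseʳ 𝟘)) (identityʳ s))) s∈S
  ... | yes Hx | no ¬Hy = subst (λ d → s ⊕ d ∈ S) (sym (identityˡ (⊖ c))) (closed⊖ s ¬Hs s∈S)
    where
    ¬Hs : ¬ H s
    ¬Hs Hs = ¬Hy (subst H (sym y≡s⊕x) (Equivalence.from (H-coset s Hx) Hs))
  ... | no ¬Hx | yes Hy =
    subst (λ d → s ⊕ d ∈ S) (sym (trans (cong (c ⊕_) ε⁻¹≈ε) (identityʳ c))) (closed s ¬Hs s∈S)
    where
    ¬Hs : ¬ H s
    ¬Hs Hs = ¬Hx (Equivalence.to (H-coset x Hs) (subst H (trans y≡s⊕x (comm s x)) Hy))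

  switch-preserves-arcs : ∀ {S c} → TranslationClosed S c → TranslationClosed S (⊖ c) →
    ∀ {x y} → Arc S x y → Arc S (switch c x) (switch c y)
  switch-preserves-arcs {S} {c} closed closed⊖ {x} {y} (s , s∈S , y≡s⊕x) =
    s ⊕ (shift c y ⊕ ⊖ shift c x) , corrected-label∈S closed closed⊖ y≡s⊕x s∈S ,
    trans (cong (_⊕ shift c y) y≡s⊕x) (⊕-rebalance s x (shift c x) (shift c y))

  switch-isDigraphAut : ∀ {S c} (Hc : H c) → TranslationClosed S c → TranslationClosed S (⊖ c) →
    IsDigraphAut S (switch-↔ Hc)
  switch-isDigraphAut {S} {c} Hc closed closed⊖ x y =
    mk⇔ (switch-preserves-arcs closed closed⊖) reflect
    where
    closed⊖⊖ : TranslationClosed S (⊖ ⊖ c)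
    closed⊖⊖ = subst (TranslationClosed S) (sym (⁻¹-involutive c)) closed
    reflect : Arc S (switch c x) (switch c y) → Arc S x y
    reflect arc = subst₂ (Arc S) (switch-inverse Hc x) (switch-inverse Hc y)
                         (switch-preserves-arcs closed⊖ closed⊖⊖ arc)

  switch-not-normal : ∀ {S c g} (Hc : H c) → c ≢ 𝟘 → ¬ H g → ¬ H (g ⊕ g) →
    IsDigraphAut S (switch-↔ Hc) → ¬ IsNormalCayley S
  switch-not-normal {S} {c} {g} Hc c≢𝟘 ¬Hg ¬H2g aut normal = c≢𝟘 c≡𝟘
    where
    h = proj₁ (normal (switch-↔ Hc) aut g)
    conjugate : ∀ x → switch c (switch (⊖ c) x ⊕ g) ≡ x ⊕ h
    conjugate = proj₂ (normal (switch-↔ Hc) aut g)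
    h≡g : h ≡ g
    h≡g = ∙-cancelˡ g h g (begin
      g ⊕ h                           ≡⟨ sym (conjugate g) ⟩
      switch c (switch (⊖ c) g ⊕ g)   ≡⟨ cong (λ z → switch c (z ⊕ g)) (switch-fixes (⊖ c) ¬Hg) ⟩
      switch c (g ⊕ g)                ≡⟨ switch-fixes c ¬H2g ⟩
      g ⊕ g                           ∎)
    ¬H[⊖c⊕g] : ¬ H (⊖ c ⊕ g)
    ¬H[⊖c⊕g] H[⊖c⊕g] =
      ¬Hg (Equivalence.to (H-coset g (H-⊖ Hc)) (subst H (comm (⊖ c) g) H[⊖c⊕g]))
    switch⊖c𝟘≡⊖c : switch (⊖ c) 𝟘 ≡ ⊖ c
    switch⊖c𝟘≡⊖c = trans (switch-moves (⊖ c) (H-𝟘 Hc)) (identityˡ (⊖ c))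
    ⊖c≡𝟘 : ⊖ c ≡ 𝟘
    ⊖c≡𝟘 = identityˡ-unique (⊖ c) g (begin
      ⊖ c ⊕ g                         ≡⟨ sym (switch-fixes c ¬H[⊖c⊕g]) ⟩
      switch c (⊖ c ⊕ g)              ≡⟨ cong (λ z → switch c (z ⊕ g)) (sym switch⊖c𝟘≡⊖c) ⟩
      switch c (switch (⊖ c) 𝟘 ⊕ g)   ≡⟨ conjugate 𝟘 ⟩
      𝟘 ⊕ h                           ≡⟨ trans (identityˡ h) h≡g ⟩
      g                               ∎)
    c≡𝟘 : c ≡ 𝟘
    c≡𝟘 = trans (sym (⁻¹-involutive c)) (trans (cong ⊖_ ⊖c≡𝟘) ε⁻¹≈ε)

module Multiples {n p : ℕ} .{{_ : NonZero n}} (p∣n : p ∣ n) where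

  Multiple : Fin n → Set
  Multiple x = p ∣ toℕ x

  multiple-⟦⟧ : ∀ {t} → p ∣ t → Multiple ⟦ t ⟧
  multiple-⟦⟧ {t} p∣t = subst (p ∣_) (sym (toℕ-⟦⟧ t)) (%-presˡ-∣ p∣t p∣n)

  ⟦⟧-multiple : ∀ {t} → Multiple ⟦ t ⟧ → p ∣ t
  ⟦⟧-multiple {t} p∣⟦t⟧ = ∣n∣m%n⇒∣m p∣n (subst (p ∣_) (toℕ-⟦⟧ t) p∣⟦t⟧)

  multiple-coset : ∀ {x} y → Multiple x → Multiple (y ⊕ x) ⇔ Multiple y
  multiple-coset {x} y p∣x = mk⇔
    (λ p∣y⊕x → ∣m+n∣m⇒∣n (subst (p ∣_) (+-comm (toℕ y) (toℕ x)) (⟦⟧-multiple p∣y⊕x)) p∣x)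
    (λ p∣y → multiple-⟦⟧ (∣m∣n⇒∣m+n p∣y p∣x))

  open Switch Multiple (λ x → p ∣? toℕ x) multiple-coset public

  translates-closed : ∀ {m u S} (α : Fin n ↔ Fin n) → Prime p → n ≡ p * m → p ∣ m → ¬ p ∣ u →
    (∀ t → Inverse.to α ⟦ t ⟧ ≡ ⟦ t * (1 + u * m) ⟧) → (∀ x → x ∈ S → Inverse.to α x ∈ S) →
    ∀ i → TranslationClosed S ⟦ i * m ⟧
  translates-closed α pr n≡pm p∣m p∤u mult α-pres i d p∤d d∈S =
    let j , orbit = orbit-translates (Inverse.to α) pr n≡pm p∣m p∤u mult d p∤d i
    in subst (_∈ _) orbit (iter-preserves (Inverse.to α) α-pres j d∈S)

p∤2 : ∀ {p} → Prime p → ¬ 2 ∣ p → ¬ p ∣ 2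
p∤2 {p} pr 2∤p p∣2 with irreducible[2] p∣2
... | inj₁ refl = nonTrivial⇒≢1 {{prime⇒nonTrivial pr}} refl
... | inj₂ refl = 2∤p ∣-refl

lemma3p1 : (n : ℕ) .{{_ : NonZero n}} (S : Subset n) → 𝟘 ∉ S →
    (p r k : ℕ) → Prime p → ¬ (2 ∣ p) → 1 ≤ r → n ≡ p ^ r * k → ¬ (p ∣ k) →
    (∃[ α ] (IsGroupAut α × FixesSet α S × HasPrimeOrder p α
              × InSylowAut (p ^ r) k α)) →
    ¬ IsNormalCayley S
lemma3p1 n S _ p zero    k _  _   ()
lemma3p1 n S _ p (suc r) k pr 2∤p _ n≡ p∤k (α , hom , fixes , order , sylow)
  with order-p-automorphism α r pr 2∤p p∤k n≡ hom order sylow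
... | u , p∤u , p∣m , mult =
  switch-not-normal p∣⟦m⟧ ⟦m⟧≢𝟘 ¬p∣⟦1⟧ ¬p∣⟦1⟧⊕⟦1⟧ (switch-isDigraphAut p∣⟦m⟧ closed⁺ closed⁻)
  where
  m = p ^ r * k
  n≡pm : n ≡ p * m
  n≡pm = trans n≡ (*-assoc p (p ^ r) k)
  open Multiples (subst (p ∣_) (sym n≡pm) (m∣m*n m)) public
  p∣⟦m⟧ : Multiple ⟦ m ⟧
  p∣⟦m⟧ = multiple-⟦⟧ p∣m
  closed : ∀ i → TranslationClosed S ⟦ i * m ⟧
  closed = translates-closed α pr n≡pm p∣m p∤u mult (λ x → proj₁ (fixes x))
  closed⁺ : TranslationClosed S ⟦ m ⟧
  closed⁺ = subst (TranslationClosed S) (cong ⟦_⟧ (*-identityˡ m)) (closed 1)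
  closed⁻ : TranslationClosed S (⊖ ⟦ m ⟧)
  closed⁻ = subst (TranslationClosed S) (sym (⊖⟦⟧≡⟦⟧ m (pred p * m) m+[p-1]m≡n)) (closed (pred p))
    where
    m+[p-1]m≡n : m + pred p * m ≡ n
    m+[p-1]m≡n = trans (cong (_* m) (suc-pred p {{prime⇒nonZero pr}})) (sym n≡pm)
  ⟦m⟧≢𝟘 : ⟦ m ⟧ ≢ 𝟘
  ⟦m⟧≢𝟘 = ⟦⟧≢𝟘 (>-nonZero⁻¹ m) (subst (m <_) (trans (*-comm m p) (sym n≡pm)) (m<m*n m p p>1))
    where
    instance _ = m*n≢0⇒n≢0 p {{subst NonZero n≡pm it}}
    p>1 = nonTrivial⇒n>1 p {{prime⇒nonTrivial pr}}
  ¬p∣⟦1⟧ : ¬ Multiple ⟦ 1 ⟧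
  ¬p∣⟦1⟧ p∣1 = p∤2 pr 2∤p (∣-trans (⟦⟧-multiple p∣1) (1∣ 2))
  ¬p∣⟦1⟧⊕⟦1⟧ : ¬ Multiple (⟦ 1 ⟧ ⊕ ⟦ 1 ⟧)
  ¬p∣⟦1⟧⊕⟦1⟧ p∣2 = p∤2 pr 2∤p (⟦⟧-multiple (subst Multiple (sym (⟦⟧-+ 1 1)) p∣2))
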